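{- For all $n \ge 1$, $|\mathcal{P}_n(132)| = p_n$, where $p_n$ is the $n$-th Pell number.
   Context: $S_n$ is the set of permutations of $\{1,\dots,n\}$ in one-line notation. A permutation avoids a pattern $\sigma\in S_k$ if it has no subsequence of length $k$ whose entries are in the same relative order as $\sigma$. $\mathcal{P}_n(132)$ denotes the set of two-stack sortable permutations in $S_n$ avoiding $132$; equivalently, the set of permutations in $S_n$ avoiding each of $132$, $2341$, $3241$. The Pell numbers are defined by $p_0=0$, $p_1=1$, $p_n=2p_{n-1}+p_{n-2}$ for $n\ge 2$. -}

module Defs where

open import Data.Bool using (Bool; true; false; _∧_; not; if_then_else_)
open import Data.Nat using (ℕ; zero; suc; _+_; _*_; _<ᵇ_; _≡ᵇ_)
open import Data.List using (List; []; _∷_; map; concatMap; applyUpTo; zip; length; filterᵇ)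
open import Data.Bool.ListAction using (all; any)
open import Data.Product using (_,_)

_==ᴮ_ : Bool → Bool → Bool
true  ==ᴮ b = b
false ==ᴮ b = not b

oneTo : ℕ → List ℕ
oneTo m = applyUpTo suc m

words : ℕ → ℕ → List (List ℕ)
words zero    m = [] ∷ []
words (suc k) m = concatMap (λ x → map (x ∷_) (words k m)) (oneTo m)

distinct : List ℕ → Bool
distinct []       = true
distinct (x ∷ xs) = all (λ y → not (x ≡ᵇ y)) xs ∧ distinct xs

-- S_n : permutations of {1,...,n} in one-line notation
-- (words of length n over {1..n} with pairwise distinct entries)
S : ℕ → List (List ℕ)
S n = filterᵇ distinct (words n n)

subseqs : List ℕ → List (List ℕ)
subseqs []       = [] ∷ []
subseqs (x ∷ xs) = let r = subseqs xs in map (x ∷_) r Data.List.++ r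

sameOrder : List ℕ → List ℕ → Bool
sameOrder []       []       = true
sameOrder []       (_ ∷ _)  = false
sameOrder (_ ∷ _)  []       = false
sameOrder (x ∷ xs) (y ∷ ys) =
  all (λ { (x′ , y′) → (x <ᵇ x′) ==ᴮ (y <ᵇ y′) }) (zip xs ys) ∧ sameOrder xs ys

contains : List ℕ → List ℕ → Bool
contains π σ = any (λ s → sameOrder s σ) (subseqs π)

avoids : List ℕ → List ℕ → Bool
avoids π σ = not (contains π σ)

P132 : ℕ → List (List ℕ)
P132 n = filterᵇ (λ π → avoids π (1 ∷ 3 ∷ 2 ∷ [])
                      ∧ avoids π (2 ∷ 3 ∷ 4 ∷ 1 ∷ [])
                      ∧ avoids π (3 ∷ 2 ∷ 4 ∷ 1 ∷ [])) (S n)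

pell : ℕ → ℕ
pell zero          = 0
pell (suc zero)    = 1
pell (suc (suc n)) = 2 * pell (suc n) + pell n

open import Relation.Binary.PropositionalEquality using (_≡_; refl)
private
  t1 : length (S 4) ≡ 24
  t1 = refl
  t2 : length (P132 4) ≡ pell 4
  t2 = refl
  t3 : length (P132 5) ≡ pell 5
  t3 = refl
  t4 : length (P132 3) ≡ 5
  t4 = refl

{-# OPTIONS --safe #-}

-- Write a member π of 𝒫ₙ₊₂(132) as α (n+2) β. An entry of α below an entry
-- of β would form a 132 with n+2, so α lies entirely above β. If both are
-- nonempty then α is a single entry, because two entries of α, then n+2, then
-- the first entry of β form a 2341 or a 3241; that entry must then be n+1.
-- So π is α (n+2), (n+2) β or (n+1) (n+2) β with α, β in the smaller classes.
-- Conversely every such word qualifies: none of 132, 2341, 3241 starts or ends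
-- with its maximum, or has its first entry exceeded only by its second one.
-- For n ≥ 1 the three families are disjoint, giving the Pell recurrence
-- |𝒫ₙ₊₂| = 2 |𝒫ₙ₊₁| + |𝒫ₙ|.

module Submission where

open import Defs
open import Data.Bool using (Bool; true; false; not; _∧_; T)
open import Data.Bool.Properties using (T-∧; T-≡; T-not-≡; T?)
open import Data.Bool.ListAction using (all)
open import Data.Empty using (⊥-elim)
open import Data.List
  using (List; []; _∷_; _++_; [_]; map; concatMap; zip; length; cartesianProductWith)
open import Data.List.Properties
  using ( length-++; length-map; length-++-sucʳ; length-applyUpTo; applyUpTo-∷ʳ
        ; ++-identityʳ; ∷-injectiveˡ; ∷-injectiveʳ; ∷ʳ-injectiveˡ)
open import Data.List.Membership.Propositional using (_∈_; _∉_; find; lose)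
open import Data.List.Membership.Propositional.Properties
  using ( ∈-++⁺ˡ; ∈-++⁺ʳ; ∈-++⁻; ∈-map⁺; ∈-map⁻; ∈-∃++; ∈-filter⁺; ∈-filter⁻; ∈-applyUpTo⁻
        ; ∈-cartesianProductWith⁺; ∈-cartesianProductWith⁻)
open import Data.List.Relation.Binary.Permutation.Propositional using (_↭_; ↭-sym; ↭⇒↭ₛ′)
open import Data.List.Relation.Binary.Permutation.Propositional.Properties
  using (shift; ↭-length; All-resp-↭; ∈-resp-↭)
import Data.List.Relation.Binary.Permutation.Setoid.Properties as Permutationₛ
open import Data.List.Relation.Binary.Sublist.Propositional
  using (_⊆_; []; _∷_; _∷ʳ_; ⊆-refl; ⊆-trans; minimum; from∈)
open import Data.List.Relation.Binary.Sublist.Propositional.Properties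
  using (All-resp-⊆; ++⁺ˡ; ++⁺ʳ; ++⁺)
open import Data.List.Relation.Unary.All as All using (All; []; _∷_)
import Data.List.Relation.Unary.All.Properties as All
open import Data.List.Relation.Unary.AllPairs using ([]; _∷_)
open import Data.List.Relation.Unary.Any using (Any; here; there; any?)
open import Data.List.Relation.Unary.Any.Properties using (any⁺; any⁻)
open import Data.List.Relation.Unary.Unique.Propositional using (Unique)
import Data.List.Relation.Unary.Unique.Propositional.Properties as Unique
open import Data.Nat using (ℕ; zero; suc; _+_; _*_; _≤_; _<_; _<ᵇ_; _≡ᵇ_; z≤n; s≤s; _<?_)
open import Data.Nat.Properties
open import Data.List.Membership.DecPropositional _≟_ using (_∈?_)
open import Data.Product using (∃; _×_; _,_; proj₁; proj₂)
open import Data.Sum as Sum using (_⊎_; inj₁; inj₂)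
open import Data.Unit using (tt)
open import Function.Base using (_∘_)
open import Function.Bundles using (Equivalence)
open import Relation.Binary.Definitions using (tri<; tri≈; tri>)
open import Relation.Binary.PropositionalEquality
  using ( _≡_; _≢_; refl; sym; trans; cong; cong₂; subst; subst₂; setoid; isEquivalence
        ; module ≡-Reasoning)
open import Relation.Nullary using (¬_; yes; no; contradiction)
open import Relation.Nullary.Decidable using (from-yes)

private
  variable
    a b c d k m n x x′ y y′ : ℕ
    xs ys s π σ α β : List ℕ

T-not⁺ : ∀ {b} → ¬ T b → T (not b)
T-not⁺ {false} _   = tt
T-not⁺ {true}  ¬tt = ¬tt tt

T-not⁻ : ∀ {b} → T (not b) → ¬ T b
T-not⁻ {false} _ ()

T-∧⁻ : ∀ {b₁ b₂} → T (b₁ ∧ b₂) → T b₁ × T b₂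
T-∧⁻ = Equivalence.to T-∧

T-∧⁺ : ∀ {b₁ b₂} → T b₁ → T b₂ → T (b₁ ∧ b₂)
T-∧⁺ t₁ t₂ = Equivalence.from T-∧ (t₁ , t₂)

==ᴮ⇒≡ : ∀ {b₁ b₂} → T (b₁ ==ᴮ b₂) → b₁ ≡ b₂
==ᴮ⇒≡ {true}  {true}  _ = refl
==ᴮ⇒≡ {false} {false} _ = refl

<⇒<ᵇ≡true : m < n → (m <ᵇ n) ≡ true
<⇒<ᵇ≡true m<n = Equivalence.to T-≡ (<⇒<ᵇ m<n)

≤⇒<ᵇ≡false : n ≤ m → (m <ᵇ n) ≡ false
≤⇒<ᵇ≡false {n} {m} n≤m = Equivalence.to T-not-≡ (T-not⁺ (≤⇒≯ n≤m ∘ <ᵇ⇒< m n))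

<ᵇ-transport : (x <ᵇ y) ≡ (m <ᵇ n) → m < n → x < y
<ᵇ-transport {x} {y} eq m<n = <ᵇ⇒< x y (subst T (sym eq) (<⇒<ᵇ m<n))

-- Order isomorphism

-- A record rather than `T (sameOrder s σ)` itself, so that Agda can infer the
-- lists from the type.
infix 4 _≅_
record _≅_ (s σ : List ℕ) : Set where
  constructor mk≅
  field holds : T (sameOrder s σ)
open _≅_

-- `_∧_` is not injective, so the first conjunct of `sameOrder` is given explicitly.
≅-tail : x ∷ xs ≅ y ∷ ys → xs ≅ ys
≅-tail {xs = xs} {ys = ys} (mk≅ h) = mk≅ (proj₂ (T-∧⁻ {all _ (zip xs ys)} h))

≅-length : s ≅ σ → length s ≡ length σ
≅-length {[]}    {[]}    _       = refl
≅-length {_ ∷ xs} {_ ∷ ys} o = cong suc (≅-length {xs} {ys} (≅-tail o))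

≅-split : x ∷ x′ ∷ xs ≅ y ∷ y′ ∷ ys → (x <ᵇ x′) ≡ (y <ᵇ y′) × x ∷ xs ≅ y ∷ ys
≅-split {x} {x′} {xs} {y} {y′} {ys} o@(mk≅ h) =
  let head≅ = (x <ᵇ x′) ==ᴮ (y <ᵇ y′)
      t-head , t-rest = T-∧⁻ {head≅} (proj₁ (T-∧⁻ {head≅ ∧ all _ (zip xs ys)} h))
  in ==ᴮ⇒≡ t-head , mk≅ (T-∧⁺ t-rest (holds (≅-tail (≅-tail o))))

≅-head : x ∷ x′ ∷ xs ≅ y ∷ y′ ∷ ys → (x <ᵇ x′) ≡ (y <ᵇ y′)
≅-head = proj₁ ∘ ≅-split

≅-delete₂ : x ∷ x′ ∷ xs ≅ y ∷ y′ ∷ ys → x ∷ xs ≅ y ∷ ys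
≅-delete₂ = proj₂ ∘ ≅-split

≅-++[]-length : xs ++ [ x ] ≅ ys ++ [ y ] → length xs ≡ length ys
≅-++[]-length {xs} {ys = ys} o =
  +-cancelʳ-≡ 1 _ _ (trans (sym (length-++ xs)) (trans (≅-length o) (length-++ ys)))

≅-first-last : ∀ xs ys → length xs ≡ length ys →
               x ∷ xs ++ [ x′ ] ≅ y ∷ ys ++ [ y′ ] → (x <ᵇ x′) ≡ (y <ᵇ y′)
≅-first-last []       []       _ o = ≅-head o
≅-first-last (_ ∷ xs) (_ ∷ ys) l o = ≅-first-last xs ys (suc-injective l) (≅-delete₂ o)

occurrence-head-max : x ∷ xs ≅ y ∷ ys → All (_< x) xs → ¬ Any (y <_) ys
occurrence-head-max {xs = _ ∷ _} o (x′<x ∷ _) (here y<y′) =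
  <-asym x′<x (<ᵇ-transport (≅-head o) y<y′)
occurrence-head-max {xs = _ ∷ _} o (_ ∷ xs<x) (there i) =
  occurrence-head-max (≅-delete₂ o) xs<x i
occurrence-head-max {xs = []} {ys = _ ∷ _} (mk≅ ()) _ _

occurrence-last-max : xs ++ [ x ] ≅ ys ++ [ y ] → All (_< x) xs → ¬ Any (y <_) ys
occurrence-last-max {_ ∷ xs} {ys = _ ∷ ys} o (x′<x ∷ _) (here y<y′) =
  <-asym y<y′ (<ᵇ-transport (sym (≅-first-last xs ys (≅-++[]-length (≅-tail o)) o)) x′<x)
occurrence-last-max {_ ∷ _} {ys = _ ∷ _} o (_ ∷ xs<x) (there y<ys) =
  occurrence-last-max (≅-tail o) xs<x y<ys
occurrence-last-max {[]} {ys = _ ∷ ys} o _ _ with () ← ≅-++[]-length {[]} {ys = _ ∷ ys} o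

-- Pattern avoidance

∈-subseqs⁺ : s ⊆ π → s ∈ subseqs π
∈-subseqs⁺ []                    = here refl
∈-subseqs⁺ (_∷ʳ_ {ys = π} x s⊆π) = ∈-++⁺ʳ (map (x ∷_) (subseqs π)) (∈-subseqs⁺ s⊆π)
∈-subseqs⁺ (refl ∷ s⊆π)          = ∈-++⁺ˡ (∈-map⁺ _ (∈-subseqs⁺ s⊆π))

∈-subseqs⁻ : ∀ π → s ∈ subseqs π → s ⊆ π
∈-subseqs⁻ []      (here refl) = []
∈-subseqs⁻ (x ∷ π) s∈ with ∈-++⁻ (map (x ∷_) (subseqs π)) s∈
... | inj₂ s∈′ = x ∷ʳ ∈-subseqs⁻ π s∈′
... | inj₁ s∈′ with t , t∈ , refl ← ∈-map⁻ (x ∷_) s∈′ = refl ∷ ∈-subseqs⁻ π t∈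

⊆-++[]⁻ : ∀ α → s ⊆ α ++ [ x ] → s ⊆ α ⊎ ∃ λ s′ → s ≡ s′ ++ [ x ] × s′ ⊆ α
⊆-++[]⁻ []      (x ∷ʳ [])    = inj₁ []
⊆-++[]⁻ []      (refl ∷ [])  = inj₂ ([] , refl , [])
⊆-++[]⁻ (a ∷ α) (a ∷ʳ s⊆)    =
  Sum.map (a ∷ʳ_) (λ (s′ , eq , s′⊆) → s′ , eq , a ∷ʳ s′⊆) (⊆-++[]⁻ α s⊆)
⊆-++[]⁻ (a ∷ α) (refl ∷ s⊆)  =
  Sum.map (refl ∷_) (λ (s′ , eq , s′⊆) → a ∷ s′ , cong (a ∷_) eq , refl ∷ s′⊆) (⊆-++[]⁻ α s⊆)

Avoids : List ℕ → List ℕ → Set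
Avoids π σ = ∀ {s} → s ⊆ π → ¬ s ≅ σ

avoids⇒Avoids : ∀ π σ → T (avoids π σ) → Avoids π σ
avoids⇒Avoids π σ t s⊆π (mk≅ h) = T-not⁻ t (any⁺ (λ s → sameOrder s σ) (lose (∈-subseqs⁺ s⊆π) h))

Avoids⇒avoids : ∀ π σ → Avoids π σ → T (avoids π σ)
Avoids⇒avoids π σ A = T-not⁺ λ t →
  let s , s∈ , h = find (any⁻ (λ s → sameOrder s σ) (subseqs π) t) in A (∈-subseqs⁻ π s∈) (mk≅ h)

Avoids-resp-⊆ : s ⊆ π → Avoids π σ → Avoids s σ
Avoids-resp-⊆ s⊆π A t⊆s = A (⊆-trans t⊆s s⊆π)

Avoids-∷ : Avoids π σ → (∀ {s} → s ⊆ π → ¬ x ∷ s ≅ σ) → Avoids (x ∷ π) σ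
Avoids-∷ A B (_ ∷ʳ s⊆) = A s⊆
Avoids-∷ A B (refl ∷ s⊆) = B s⊆

Avoids-∷-max : All (_< x) π → Any (y <_) ys → Avoids π (y ∷ ys) → Avoids (x ∷ π) (y ∷ ys)
Avoids-∷-max π<x y<ys A = Avoids-∷ A λ s⊆π o → occurrence-head-max o (All-resp-⊆ s⊆π π<x) y<ys

Avoids-∷-∷-max : All (_< x) π → Any (y <_) ys →
                 Avoids π (y ∷ y′ ∷ ys) → Avoids (x ∷ suc x ∷ π) (y ∷ y′ ∷ ys)
Avoids-∷-∷-max π<x y<ys A = Avoids-∷ (Avoids-∷-max (All.map m<n⇒m<1+n π<x) (there y<ys) A) λ where
  (_ ∷ʳ s⊆π)  o → occurrence-head-max o (All-resp-⊆ s⊆π π<x) (there y<ys)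
  (refl ∷ s⊆π) o → occurrence-head-max (≅-delete₂ o) (All-resp-⊆ s⊆π π<x) y<ys

Avoids-++[]-max : All (_< x) π → Any (y <_) ys →
                  Avoids π (ys ++ [ y ]) → Avoids (π ++ [ x ]) (ys ++ [ y ])
Avoids-++[]-max {π = π} π<x y<ys A s⊆ o with ⊆-++[]⁻ π s⊆
... | inj₁ s⊆π                = A s⊆π o
... | inj₂ (s′ , refl , s′⊆π) = occurrence-last-max o (All-resp-⊆ s′⊆π π<x) y<ys

σ132 σ2341 σ3241 : List ℕ
σ132  = 1 ∷ 3 ∷ 2 ∷ []
σ2341 = 2 ∷ 3 ∷ 4 ∷ 1 ∷ []
σ3241 = 3 ∷ 2 ∷ 4 ∷ 1 ∷ []

AvoidsPatterns : List ℕ → Set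
AvoidsPatterns π = Avoids π σ132 × Avoids π σ2341 × Avoids π σ3241

AvoidsPatterns-resp-⊆ : s ⊆ π → AvoidsPatterns π → AvoidsPatterns s
AvoidsPatterns-resp-⊆ s⊆π (A₁ , A₂ , A₃) =
  Avoids-resp-⊆ s⊆π A₁ , Avoids-resp-⊆ s⊆π A₂ , Avoids-resp-⊆ s⊆π A₃

AvoidsPatterns-∷-max : All (_< x) π → AvoidsPatterns π → AvoidsPatterns (x ∷ π)
AvoidsPatterns-∷-max π<x (A₁ , A₂ , A₃) =
  Avoids-∷-max π<x (from-yes (any? (1 <?_) (3 ∷ 2 ∷ []))) A₁ ,
  Avoids-∷-max π<x (from-yes (any? (2 <?_) (3 ∷ 4 ∷ 1 ∷ []))) A₂ ,
  Avoids-∷-max π<x (from-yes (any? (3 <?_) (2 ∷ 4 ∷ 1 ∷ []))) A₃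

AvoidsPatterns-∷-∷-max : All (_< x) π → AvoidsPatterns π → AvoidsPatterns (x ∷ suc x ∷ π)
AvoidsPatterns-∷-∷-max π<x (A₁ , A₂ , A₃) =
  Avoids-∷-∷-max π<x (from-yes (any? (1 <?_) (2 ∷ []))) A₁ ,
  Avoids-∷-∷-max π<x (from-yes (any? (2 <?_) (4 ∷ 1 ∷ []))) A₂ ,
  Avoids-∷-∷-max π<x (from-yes (any? (3 <?_) (4 ∷ 1 ∷ []))) A₃

AvoidsPatterns-++[]-max : All (_< x) π → AvoidsPatterns π → AvoidsPatterns (π ++ [ x ])
AvoidsPatterns-++[]-max π<x (A₁ , A₂ , A₃) =
  Avoids-++[]-max {ys = 1 ∷ 3 ∷ []}     π<x (from-yes (any? (2 <?_) (1 ∷ 3 ∷ []))) A₁ ,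
  Avoids-++[]-max {ys = 2 ∷ 3 ∷ 4 ∷ []} π<x (from-yes (any? (1 <?_) (2 ∷ 3 ∷ 4 ∷ []))) A₂ ,
  Avoids-++[]-max {ys = 3 ∷ 2 ∷ 4 ∷ []} π<x (from-yes (any? (1 <?_) (3 ∷ 2 ∷ 4 ∷ []))) A₃

occurrence-132 : a < b → b < c → a ∷ c ∷ b ∷ [] ≅ σ132
occurrence-132 {a} {b} {c} a<b b<c = mk≅ t
  where
  t : T (sameOrder (a ∷ c ∷ b ∷ []) σ132)
  t rewrite <⇒<ᵇ≡true (<-trans a<b b<c) | <⇒<ᵇ≡true a<b | ≤⇒<ᵇ≡false (<⇒≤ b<c) = tt

occurrence-2341 : d < a → a < b → b < c → a ∷ b ∷ c ∷ d ∷ [] ≅ σ2341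
occurrence-2341 {d} {a} {b} {c} d<a a<b b<c = mk≅ t
  where
  d<b : d < b
  d<b = <-trans d<a a<b
  t : T (sameOrder (a ∷ b ∷ c ∷ d ∷ []) σ2341)
  t rewrite <⇒<ᵇ≡true a<b | <⇒<ᵇ≡true (<-trans a<b b<c) | ≤⇒<ᵇ≡false (<⇒≤ d<a)
          | <⇒<ᵇ≡true b<c | ≤⇒<ᵇ≡false (<⇒≤ d<b)
          | ≤⇒<ᵇ≡false (<⇒≤ (<-trans d<b b<c)) = tt

occurrence-3241 : d < b → b < a → a < c → a ∷ b ∷ c ∷ d ∷ [] ≅ σ3241
occurrence-3241 {d} {b} {a} {c} d<b b<a a<c = mk≅ t
  where
  d<a : d < a
  d<a = <-trans d<b b<a
  t : T (sameOrder (a ∷ b ∷ c ∷ d ∷ []) σ3241)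
  t rewrite ≤⇒<ᵇ≡false (<⇒≤ b<a) | <⇒<ᵇ≡true a<c | ≤⇒<ᵇ≡false (<⇒≤ d<a)
          | <⇒<ᵇ≡true (<-trans b<a a<c) | ≤⇒<ᵇ≡false (<⇒≤ d<b)
          | ≤⇒<ᵇ≡false (<⇒≤ (<-trans d<a a<c)) = tt

-- Permutations of 1, …, n

IsPerm : ℕ → List ℕ → Set
IsPerm n π = length π ≡ n × All (_∈ oneTo n) π × Unique π

oneTo-suc : ∀ n → oneTo (suc n) ≡ oneTo n ++ [ suc n ]
oneTo-suc n = sym (applyUpTo-∷ʳ suc n)

∈-oneTo⇒≤ : x ∈ oneTo n → x ≤ n
∈-oneTo⇒≤ x∈ with _ , i<n , refl ← ∈-applyUpTo⁻ suc x∈ = i<n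

max∈oneTo : ∀ n → suc n ∈ oneTo (suc n)
max∈oneTo n = subst (suc n ∈_) (sym (oneTo-suc n)) (∈-++⁺ʳ (oneTo n) (here refl))

∈-oneTo-suc⁺ : x ∈ oneTo n → x ∈ oneTo (suc n)
∈-oneTo-suc⁺ {n = n} x∈ = subst (_ ∈_) (sym (oneTo-suc n)) (∈-++⁺ˡ x∈)

∈-oneTo-suc⁻ : x ∈ oneTo (suc n) → x ≢ suc n → x ∈ oneTo n
∈-oneTo-suc⁻ {n = n} x∈ x≢ with ∈-++⁻ (oneTo n) (subst (_ ∈_) (oneTo-suc n) x∈)
... | inj₁ x∈′        = x∈′
... | inj₂ (here x≡) = contradiction x≡ x≢

Unique-oneTo : ∀ n → Unique (oneTo n)
Unique-oneTo n = Unique.applyUpTo⁺₁ suc n (λ i<j _ → <⇒≢ i<j ∘ suc-injective)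

Unique-resp-↭ : xs ↭ ys → Unique xs → Unique ys
Unique-resp-↭ p = Permutationₛ.Unique-resp-↭ (setoid ℕ) (↭⇒↭ₛ′ isEquivalence p)

IsPerm-resp-↭ : π ↭ σ → IsPerm n π → IsPerm n σ
IsPerm-resp-↭ p (len , π⊆ , u) = trans (sym (↭-length p)) len , All-resp-↭ p π⊆ , Unique-resp-↭ p u

IsPerm⇒All< : IsPerm n π → All (_< suc n) π
IsPerm⇒All< (_ , π⊆ , _) = All.map (s≤s ∘ ∈-oneTo⇒≤) π⊆

IsPerm-∷-max : IsPerm n π → IsPerm (suc n) (suc n ∷ π)
IsPerm-∷-max {n} (len , π⊆ , u) =
  cong suc len ,
  max∈oneTo n ∷ All.map ∈-oneTo-suc⁺ π⊆ ,
  All.map (λ x∈ n≡x → 1+n≰n (subst (_≤ n) (sym n≡x) (∈-oneTo⇒≤ x∈))) π⊆ ∷ u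

IsPerm-∷-max⁻ : IsPerm (suc n) (suc n ∷ π) → IsPerm n π
IsPerm-∷-max⁻ (len , _ ∷ π⊆ , n∉π ∷ u) =
  suc-injective len , All.zipWith (λ (x∈ , n≢x) → ∈-oneTo-suc⁻ x∈ (n≢x ∘ sym)) (π⊆ , n∉π) , u

IsPerm-insert-max : ∀ α → IsPerm n (α ++ β) → IsPerm (suc n) (α ++ suc n ∷ β)
IsPerm-insert-max α p = IsPerm-resp-↭ (↭-sym (shift _ α _)) (IsPerm-∷-max p)

IsPerm-remove-max : ∀ α → IsPerm (suc n) (α ++ suc n ∷ β) → IsPerm n (α ++ β)
IsPerm-remove-max α p = IsPerm-∷-max⁻ (IsPerm-resp-↭ (shift _ α _) p)

Unique⇒length≤ : ∀ {A : Set} {xs ys : List A} →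
                 Unique xs → (∀ {z} → z ∈ xs → z ∈ ys) → length xs ≤ length ys
Unique⇒length≤ [] _ = z≤n
Unique⇒length≤ {xs = x ∷ xs} (x∉xs ∷ u) xs⊆ys with α , β , refl ← ∈-∃++ (xs⊆ys (here refl)) =
  subst (suc (length xs) ≤_) (sym (length-++-sucʳ α x β)) (s≤s (Unique⇒length≤ u xs⊆α++β))
  where
  xs⊆α++β : ∀ {z} → z ∈ xs → z ∈ α ++ β
  xs⊆α++β z∈ with ∈-resp-↭ (shift x α β) (xs⊆ys (there z∈))
  ... | here refl = contradiction refl (All.lookup x∉xs z∈)
  ... | there z∈′ = z∈′

IsPerm⇒∈ : IsPerm n π → x ∈ oneTo n → x ∈ π
IsPerm⇒∈ {n} {π} {x} (len , π⊆ , u) x∈ with x ∈? π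
... | yes x∈π = x∈π
... | no  x∉π = contradiction (subst₂ _≤_ (cong suc len) (length-applyUpTo suc n) x∷π⊆) 1+n≰n
  where
  x∷π⊆ : length (x ∷ π) ≤ length (oneTo n)
  x∷π⊆ = Unique⇒length≤ (All.tabulate (λ z∈ x≡z → x∉π (subst (_∈ π) (sym x≡z) z∈)) ∷ u) λ where
    (here refl) → x∈
    (there z∈)  → All.lookup π⊆ z∈

IsPerm-head-max : IsPerm (suc n) (x ∷ π) → All (_≤ x) π → x ≡ suc n
IsPerm-head-max {n} p@(_ , x∈ ∷ _ , _) π≤x with IsPerm⇒∈ p (max∈oneTo n)
... | here n≡x   = sym n≡x
... | there n∈π = ≤-antisym (∈-oneTo⇒≤ x∈) (All.lookup π≤x n∈π)

words-suc : ∀ k m → words (suc k) m ≡ cartesianProductWith _∷_ (oneTo m) (words k m)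
words-suc k m = go (oneTo m)
  where
  go : ∀ xs → concatMap (λ x → map (x ∷_) (words k m)) xs ≡ cartesianProductWith _∷_ xs (words k m)
  go []       = refl
  go (x ∷ xs) = cong (map (x ∷_) (words k m) ++_) (go xs)

∈-words⁻ : ∀ k → π ∈ words k m → length π ≡ k × All (_∈ oneTo m) π
∈-words⁻ zero    (here refl) = refl , []
∈-words⁻ {m = m} (suc k) π∈
  with x , π′ , x∈ , π′∈ , refl ← ∈-cartesianProductWith⁻ _∷_ (oneTo m) (words k m)
                                      (subst (_ ∈_) (words-suc k m) π∈)
  with len , π′⊆ ← ∈-words⁻ k π′∈ = cong suc len , x∈ ∷ π′⊆

∈-words⁺ : All (_∈ oneTo m) π → π ∈ words (length π) m
∈-words⁺ []                   = here refl
∈-words⁺ {m} {x ∷ π} (x∈ ∷ π⊆) =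
  subst (_ ∈_) (sym (words-suc (length π) m)) (∈-cartesianProductWith⁺ _∷_ x∈ (∈-words⁺ π⊆))

Unique-words : ∀ k m → Unique (words k m)
Unique-words zero    m = [] ∷ []
Unique-words (suc k) m = subst Unique (sym (words-suc k m))
  (Unique.cartesianProductWith⁺ _∷_ (λ { refl → refl , refl }) (Unique-oneTo m) (Unique-words k m))

distinct⇒Unique : ∀ xs → T (distinct xs) → Unique xs
distinct⇒Unique []       _ = []
distinct⇒Unique (x ∷ xs) t =
  let t-head , t-tail = T-∧⁻ {all (λ y → not (x ≡ᵇ y)) xs} t
  in All.map (λ {y} t-x≢y x≡y → T-not⁻ t-x≢y (≡⇒≡ᵇ x y x≡y)) (All.all⁺ _ xs t-head)
     ∷ distinct⇒Unique xs t-tail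

Unique⇒distinct : Unique xs → T (distinct xs)
Unique⇒distinct []                 = tt
Unique⇒distinct {x ∷ xs} (x∉xs ∷ u) =
  T-∧⁺ (All.all⁻ _ (All.map (λ {y} x≢y → T-not⁺ (x≢y ∘ ≡ᵇ⇒≡ x y)) x∉xs)) (Unique⇒distinct u)

∈-S⁻ : π ∈ S n → IsPerm n π
∈-S⁻ {n = n} π∈ with π∈words , t ← ∈-filter⁻ (T? ∘ distinct) {xs = words n n} π∈
  with len , π⊆ ← ∈-words⁻ n π∈words = len , π⊆ , distinct⇒Unique _ t

∈-S⁺ : IsPerm n π → π ∈ S n
∈-S⁺ (refl , π⊆ , u) = ∈-filter⁺ (T? ∘ distinct) (∈-words⁺ π⊆) (Unique⇒distinct u)

Unique-S : ∀ n → Unique (S n)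
Unique-S n = Unique.filter⁺ (T? ∘ distinct) (Unique-words n n)

avoidsPatterns : List ℕ → Bool
avoidsPatterns π = avoids π σ132 ∧ avoids π σ2341 ∧ avoids π σ3241

∈-P132⁻ : π ∈ P132 n → IsPerm n π × AvoidsPatterns π
∈-P132⁻ {π} {n} π∈ with π∈S , t ← ∈-filter⁻ (T? ∘ avoidsPatterns) {xs = S n} π∈ =
  let t₁ , t₂₃ = T-∧⁻ {avoids π σ132} t
      t₂ , t₃  = T-∧⁻ {avoids π σ2341} t₂₃
  in ∈-S⁻ π∈S , avoids⇒Avoids π σ132 t₁ , avoids⇒Avoids π σ2341 t₂ , avoids⇒Avoids π σ3241 t₃

∈-P132⁺ : IsPerm n π → AvoidsPatterns π → π ∈ P132 n
∈-P132⁺ {π = π} p (A₁ , A₂ , A₃) = ∈-filter⁺ (T? ∘ avoidsPatterns) (∈-S⁺ p)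
  (T-∧⁺ (Avoids⇒avoids π σ132 A₁) (T-∧⁺ (Avoids⇒avoids π σ2341 A₂) (Avoids⇒avoids π σ3241 A₃)))

Unique-P132 : ∀ n → Unique (P132 n)
Unique-P132 n = Unique.filter⁺ (T? ∘ avoidsPatterns) (Unique-S n)

-- Splitting at the maximum

P132-rec : ℕ → List (List ℕ)
P132-rec n = map (_++ [ suc (suc n) ]) (P132 (suc n))
          ++ map (suc (suc n) ∷_) (P132 (suc n))
          ++ map (λ β → suc n ∷ suc (suc n) ∷ β) (P132 n)

left-of-max-dominates : All (_< m) β → Avoids (α ++ m ∷ β) σ132 → All (λ x → All (_≤ x) β) α
left-of-max-dominates β<m A = All.tabulate λ x∈α → All.tabulate λ y∈β →
  ≮⇒≥ λ x<y → A (++⁺ (from∈ x∈α) (refl ∷ from∈ y∈β)) (occurrence-132 x<y (All.lookup β<m y∈β))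

occurrence-2341-or-3241 : b < x → b < y → x < m → y < m → x ≢ y →
                          x ∷ y ∷ m ∷ b ∷ [] ≅ σ2341 ⊎ x ∷ y ∷ m ∷ b ∷ [] ≅ σ3241
occurrence-2341-or-3241 {x = x} {y} b<x b<y x<m y<m x≢y with <-cmp x y
... | tri< x<y _ _ = inj₁ (occurrence-2341 b<x x<y y<m)
... | tri≈ _ x≡y _ = contradiction x≡y x≢y
... | tri> _ _ y<x = inj₂ (occurrence-3241 b<y y<x x<m)

two-left-of-max : x < m → y < m → b ≤ x → b ≤ y → Unique (x ∷ y ∷ α ++ m ∷ b ∷ β) →
                  ¬ AvoidsPatterns (x ∷ y ∷ α ++ m ∷ b ∷ β)
two-left-of-max {x} {m} {y} {b} {α} {β} x<m y<m b≤x b≤y (x∉ ∷ y∉ ∷ _) (_ , A₂ , A₃) =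
  Sum.[ A₂ xymb⊆ , A₃ xymb⊆ ] (occurrence-2341-or-3241 b<x b<y x<m y<m (All.head x∉))
  where
  xymb⊆ : x ∷ y ∷ m ∷ b ∷ [] ⊆ x ∷ y ∷ α ++ m ∷ b ∷ β
  xymb⊆ = refl ∷ refl ∷ ++⁺ˡ α (refl ∷ refl ∷ minimum β)
  b∈ : b ∈ α ++ m ∷ b ∷ β
  b∈ = ∈-++⁺ʳ α (there (here refl))
  b<x : b < x
  b<x = ≤∧≢⇒< b≤x (λ b≡x → All.lookup x∉ (there b∈) (sym b≡x))
  b<y : b < y
  b<y = ≤∧≢⇒< b≤y (λ b≡y → All.lookup y∉ b∈ (sym b≡y))

single-left-of-max : IsPerm (suc (suc m)) (x ∷ suc (suc m) ∷ β) →
                     Avoids (x ∷ suc (suc m) ∷ β) σ132 → x ≡ suc m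
single-left-of-max {m} {x} {β = β} p A =
  IsPerm-head-max q (All.head (left-of-max-dominates {α = x ∷ []} (All.tail (IsPerm⇒All< q)) A))
  where
  q : IsPerm (suc m) (x ∷ β)
  q = IsPerm-remove-max (x ∷ []) p

split-at-max : ∀ α β → let m = suc (suc n) in IsPerm m (α ++ m ∷ β) → AvoidsPatterns (α ++ m ∷ β) →
               α ++ m ∷ β ∈ P132-rec n
split-at-max {n} α []      p A =
  ∈-++⁺ˡ (∈-map⁺ _ (∈-P132⁺ (subst (IsPerm _) (++-identityʳ α) (IsPerm-remove-max α p))
                            (AvoidsPatterns-resp-⊆ (++⁺ʳ _ ⊆-refl) A)))
split-at-max {n} []      (b ∷ β) p A =
  ∈-++⁺ʳ (map _ (P132 (suc n)))
    (∈-++⁺ˡ (∈-map⁺ _ (∈-P132⁺ (IsPerm-remove-max [] p) (AvoidsPatterns-resp-⊆ (_ ∷ʳ ⊆-refl) A))))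
split-at-max {n} (x ∷ []) (b ∷ β) p A with refl ← single-left-of-max p (proj₁ A) =
  ∈-++⁺ʳ (map _ (P132 (suc n))) (∈-++⁺ʳ (map _ (P132 (suc n)))
    (∈-map⁺ _ (∈-P132⁺ (IsPerm-remove-max [] (IsPerm-remove-max (x ∷ []) p))
                       (AvoidsPatterns-resp-⊆ (_ ∷ʳ _ ∷ʳ ⊆-refl) A))))
split-at-max {n} (x ∷ y ∷ α) (b ∷ β) p A =
  ⊥-elim (two-left-of-max (All.head below) (All.head (All.tail below))
                          (All.head (All.head dominates)) (All.head (All.head (All.tail dominates)))
                          (proj₂ (proj₂ p)) A)
  where
  below : All (_< suc (suc n)) (x ∷ y ∷ α ++ b ∷ β)
  below = IsPerm⇒All< (IsPerm-remove-max (x ∷ y ∷ α) p)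
  dominates : All (λ z → All (_≤ z) (b ∷ β)) (x ∷ y ∷ α)
  dominates = left-of-max-dominates (All.++⁻ʳ (x ∷ y ∷ α) below) (proj₁ A)

P132⊆P132-rec : π ∈ P132 (suc (suc n)) → π ∈ P132-rec n
P132⊆P132-rec {n = n} π∈ with p , A ← ∈-P132⁻ π∈
  with α , β , refl ← ∈-∃++ (IsPerm⇒∈ p (max∈oneTo (suc n))) = split-at-max α β p A

P132-rec⊆P132 : π ∈ P132-rec n → π ∈ P132 (suc (suc n))
P132-rec⊆P132 {n = n} π∈ with ∈-++⁻ (map (_++ [ suc (suc n) ]) (P132 (suc n))) π∈
... | inj₁ π∈₁ with α , α∈ , refl ← ∈-map⁻ _ π∈₁ with p , A ← ∈-P132⁻ α∈ =
  ∈-P132⁺ (IsPerm-insert-max α (subst (IsPerm _) (sym (++-identityʳ α)) p))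
          (AvoidsPatterns-++[]-max (IsPerm⇒All< p) A)
... | inj₂ π∈₂₃ with ∈-++⁻ (map (suc (suc n) ∷_) (P132 (suc n))) π∈₂₃
...   | inj₁ π∈₂ with β , β∈ , refl ← ∈-map⁻ _ π∈₂ with p , A ← ∈-P132⁻ β∈ =
  ∈-P132⁺ (IsPerm-∷-max p) (AvoidsPatterns-∷-max (IsPerm⇒All< p) A)
...   | inj₂ π∈₃ with β , β∈ , refl ← ∈-map⁻ _ π∈₃ with p , A ← ∈-P132⁻ β∈ =
  ∈-P132⁺ (IsPerm-insert-max (suc n ∷ []) (IsPerm-∷-max p))
          (AvoidsPatterns-∷-∷-max (IsPerm⇒All< p) A)

++-∷-injectiveˡ : x ∉ α → x ∉ β → α ++ x ∷ xs ≡ β ++ x ∷ ys → α ≡ β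
++-∷-injectiveˡ {α = []}    {β = []}    _   _   _  = refl
++-∷-injectiveˡ {α = []}    {β = _ ∷ _} _   x∉β eq = contradiction (here (∷-injectiveˡ eq)) x∉β
++-∷-injectiveˡ {α = _ ∷ _} {β = []}    x∉α _   eq = contradiction (here (∷-injectiveˡ (sym eq))) x∉α
++-∷-injectiveˡ {α = _ ∷ _} {β = _ ∷ _} x∉α x∉β eq =
  cong₂ _∷_ (∷-injectiveˡ eq) (++-∷-injectiveˡ (x∉α ∘ there) (x∉β ∘ there) (∷-injectiveʳ eq))

All<⇒∉ : All (_< x) xs → x ∉ xs
All<⇒∉ xs<x x∈xs = <-irrefl refl (All.lookup xs<x x∈xs)

-- The three families are told apart by the position of the maximum: the
-- members of P132 (2 + k) have length 2 + k, which is neither 0 nor 1.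
Unique-P132-rec : ∀ k → Unique (P132-rec (suc k))
Unique-P132-rec k =
  Unique.++⁺ (Unique.map⁺ (∷ʳ-injectiveˡ _ _) (Unique-P132 M))
    (Unique.++⁺ (Unique.map⁺ ∷-injectiveʳ (Unique-P132 M))
                (Unique.map⁺ (∷-injectiveʳ ∘ ∷-injectiveʳ) (Unique-P132 (suc k)))
                disjoint₂₃)
    disjoint₁
  where
  M N : ℕ
  M = suc (suc k)
  N = suc M
  disjoint₂₃ : ∀ {π} → ¬ (π ∈ map (N ∷_) (P132 M) × π ∈ map (λ β → M ∷ N ∷ β) (P132 (suc k)))
  disjoint₂₃ (π∈₂ , π∈₃) with _ , _ , refl ← ∈-map⁻ _ π∈₂ with _ , _ , eq ← ∈-map⁻ _ π∈₃ =
    1+n≢n (∷-injectiveˡ eq)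
  max-position : α ∈ P132 M → ∀ {γ} → N ∉ γ → α ++ [ N ] ≡ γ ++ N ∷ β → length γ ≡ M
  max-position α∈ N∉γ eq with p , _ ← ∈-P132⁻ α∈ =
    trans (cong length (sym (++-∷-injectiveˡ (All<⇒∉ (IsPerm⇒All< p)) N∉γ eq))) (proj₁ p)
  disjoint₁ : ∀ {π} → ¬ (π ∈ map (_++ [ N ]) (P132 M) ×
                         π ∈ map (N ∷_) (P132 M) ++ map (λ β → M ∷ N ∷ β) (P132 (suc k)))
  disjoint₁ (π∈₁ , π∈₂₃) with α , α∈ , refl ← ∈-map⁻ _ π∈₁ with ∈-++⁻ (map (N ∷_) (P132 M)) π∈₂₃
  ... | inj₁ π∈₂ with _ , _ , eq ← ∈-map⁻ _ π∈₂
    with () ← max-position α∈ {γ = []} (λ ()) eq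
  ... | inj₂ π∈₃ with _ , _ , eq ← ∈-map⁻ _ π∈₃
    with () ← max-position α∈ {γ = M ∷ []} (All<⇒∉ (n<1+n M ∷ [])) eq

length-P132-rec : ∀ n → length (P132-rec n) ≡ 2 * length (P132 (suc n)) + length (P132 n)
length-P132-rec n = begin
  length (P132-rec n)
    ≡⟨ length-++ (map _ (P132 (suc n))) ⟩
  length (map _ (P132 (suc n))) + length (map _ (P132 (suc n)) ++ map _ (P132 n))
    ≡⟨ cong₂ _+_ (length-map _ (P132 (suc n)))
                 (trans (length-++ (map _ (P132 (suc n))))
                        (cong₂ _+_ (length-map _ (P132 (suc n))) (length-map _ (P132 n)))) ⟩
  n₁ + (n₁ + n₀)
    ≡⟨ sym (+-assoc n₁ n₁ n₀) ⟩
  n₁ + n₁ + n₀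
    ≡⟨ cong (λ z → n₁ + z + n₀) (sym (+-identityʳ n₁)) ⟩
  2 * n₁ + n₀ ∎
  where
  open ≡-Reasoning
  n₁ n₀ : ℕ
  n₁ = length (P132 (suc n))
  n₀ = length (P132 n)

P132-recurrence : ∀ k → length (P132 (3 + k)) ≡ 2 * length (P132 (2 + k)) + length (P132 (1 + k))
P132-recurrence k = trans (≤-antisym P132≤rec rec≤P132) (length-P132-rec (suc k))
  where
  P132≤rec : length (P132 (3 + k)) ≤ length (P132-rec (suc k))
  P132≤rec = Unique⇒length≤ (Unique-P132 (3 + k)) (P132⊆P132-rec {n = suc k})
  rec≤P132 : length (P132-rec (suc k)) ≤ length (P132 (3 + k))
  rec≤P132 = Unique⇒length≤ (Unique-P132-rec k) (P132-rec⊆P132 {n = suc k})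

mainTheorem2 : (n : ℕ) → 1 ≤ n → length (P132 n) ≡ pell n
mainTheorem2 1 _ = refl
mainTheorem2 2 _ = refl
mainTheorem2 (suc (suc (suc k))) _ = begin
  length (P132 (3 + k))
    ≡⟨ P132-recurrence k ⟩
  2 * length (P132 (2 + k)) + length (P132 (1 + k))
    ≡⟨ cong₂ (λ p q → 2 * p + q) (mainTheorem2 (suc (suc k)) (s≤s z≤n)) (mainTheorem2 (suc k) (s≤s z≤n)) ⟩
  2 * pell (2 + k) + pell (1 + k)
    ∎
  where open ≡-Reasoning
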